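{- Let $\varepsilon_0 \in \{\pm 1\}$ and let $A$ be a set of prime powers with $|A| \ge 3$ such that, whenever $q$ is a prime dividing $\prod_{a \in B} a - \varepsilon_0$ for some $B \in \mathcal P_\star(A)$, $q$ divides some element of $A$. Then $A$ is infinite.
   Context: A prime power is a number of the form $p^k$ with $p$ prime and $k \ge 1$. For a set $X$, $\mathcal P_\star(X)$ denotes the family of all finite nonempty proper subsets of $X$. -}

module Defs where

open import Level using (Level)
open import Data.Nat using (ℕ; _^_; _≥_)
open import Data.Nat.Primality using (Prime)
open import Data.Nat.Divisibility using (_∣_)
open import Data.Integer as ℤ using (ℤ; +_; -_; _-_)
open import Data.List using (List; []; _∷_)
open import Data.Nat.ListAction using (product)
open import Data.List.Membership.Propositional using (_∈_; _∉_)
open import Data.List.Relation.Unary.All using (All)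
open import Data.List.Relation.Unary.Unique.Propositional using (Unique)
open import Data.Product using (Σ; ∃; ∃-syntax; _×_)
open import Data.Sum using (_⊎_)
open import Relation.Binary.PropositionalEquality using (_≡_; _≢_)
open import Relation.Nullary using (¬_)

IsPrimePower : ℕ → Set
IsPrimePower a = ∃[ p ] ∃[ k ] (Prime p × k ≥ 1 × a ≡ p ^ k)

FiniteSet : (ℕ → Set) → Set
FiniteSet A = ∃[ xs ] (∀ n → A n → n ∈ xs)

AtLeast3 : (ℕ → Set) → Set
AtLeast3 A = ∃[ x ] ∃[ y ] ∃[ z ]
  (A x × A y × A z × x ≢ y × x ≢ z × y ≢ z)

-- B ∈ 𝒫⋆(A): a finite nonempty proper subset of A, given as a
-- duplicate-free list of elements of A, nonempty, missing some element of A.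
IsFinNonemptyProperSubset : (ℕ → Set) → List ℕ → Set
IsFinNonemptyProperSubset A B =
  Unique B × All A B × B ≢ [] × ∃[ a ] (A a × a ∉ B)

IsSign : ℤ → Set
IsSign ε = ε ≡ + 1 ⊎ ε ≡ - (+ 1)

prodMinus : List ℕ → ℤ → ℤ
prodMinus B ε = + (product B) - ε

-- Suppose A is finite and enumerate it as a < b < c < ⋯, and let D be the
-- product of all elements except a and b.  A prime factor of ∏B − ε is
-- coprime to every element of B, so it divides an element of A ∖ B.  Hence,
-- writing a = pⁱ and b = rʲ:  D − ε = pˣ rʸ,  bD − ε is a power of p and
-- aD − ε is a power of r.  Since |D − ε| < |bD − ε|, pˣ divides both D − ε
-- and bD − ε, hence b(D − ε) − (bD − ε) = ε(1 − b), so pˣ ≤ b − 1; likewise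
-- rʸ ≤ a − 1, giving D ≤ (a − 1)(b − 1) + 1 (pairBound).
-- If A has at least four elements, D ≥ cd > (b + 1)², a contradiction.
-- If A = {a, b, c} then c ≤ (a − 1)(b − 1) + 1; a = 2 forces c ≤ b, and for
-- a ≥ 3 we get a ∣ bc − ε, b ∣ ac − ε, c ∣ ab − ε, which is impossible since
-- then abc divides the nonzero number ab + bc + ca − ε, smaller than abc.
-- A is not decidable, so the enumeration is obtained under a double negation.
module Submission where

open import Defs
open import Data.Nat using (ℕ; zero; suc; _+_; _*_; _∸_; _^_; _≤_; _<_; z≤n; s≤s; NonZero; ≢-nonZero; >-nonZero; nonTrivial⇒n>1)
open import Data.Nat.Properties
open import Data.Nat.Primality using (Prime; euclidsLemma; prime⇒irreducible; prime⇒nonTrivial; prime⇒nonZero; ¬prime[1])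
open import Data.Nat.Primality.Factorisation using (factorise)
open import Data.Nat.Divisibility using (_∣_; divides; ∣1⇒≡1; ∣⇒≤; ∣-trans; ∣-refl; *-pres-∣; m∣m*n)
open import Data.Nat.Coprimality using (Coprime; coprime-divisor)
open import Data.Nat.ListAction using (product)
open import Data.Nat.ListAction.Properties using (∈⇒∣product; product≢0)
open import Data.Integer as ℤ using (ℤ; ∣_∣; +_)
import Data.Integer.Properties as ℤP
import Data.Integer.Divisibility.Signed as ℤD
import Data.Integer.Tactic.RingSolver as ℤ-Solver
import Data.Nat.Tactic.RingSolver as ℕ-Solver
open import Data.List using (List; []; _∷_)
open import Data.List.Relation.Unary.All as All using (All; []; _∷_)
open import Data.List.Relation.Unary.All.Properties using (All¬⇒¬Any)
open import Data.List.Relation.Unary.AllPairs as AllPairs using (AllPairs; []; _∷_)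
open import Data.List.Relation.Unary.Any as Any using (Any; here; there)
import Data.List.Relation.Unary.Any.Properties as AnyP
open import Data.List.Membership.Propositional using (_∈_)
open import Data.List.Membership.Propositional.Properties using (∈-++⁺ˡ; ∈-++⁻)
open import Data.Product using (∃-syntax; _×_; _,_; proj₁; proj₂)
open import Data.Sum as Sum using (_⊎_; inj₁; inj₂; [_,_]′)
open import Data.Empty using (⊥; ⊥-elim)
open import Function using (id)
open import Relation.Nullary using (¬_)
open import Relation.Binary.Definitions using (tri<; tri≈; tri>)
open import Relation.Binary.PropositionalEquality

gap : ℤ → ℕ → ℕ
gap ε N = ∣ + N ℤ.- ε ∣

SupportedBy : ℕ → List ℕ → Set
SupportedBy n xs = ∀ q → Prime q → q ∣ n → Any (q ∣_) xs

Enumeration : (ℕ → Set) → List ℕ → Set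
Enumeration A L = AllPairs _<_ L × All A L × (∀ n → A n → n ∈ L)

positive : ∀ {m n} → m < n → NonZero n
positive m<n = >-nonZero (≤-<-trans z≤n m<n)

∣sign∣≡1 : ∀ {ε} → IsSign ε → ∣ ε ∣ ≡ 1
∣sign∣≡1 (inj₁ refl) = refl
∣sign∣≡1 (inj₂ refl) = refl

gap-bounds : ∀ {ε} → IsSign ε → ∀ N → N ∸ 1 ≤ gap ε N × gap ε N ≤ N + 1
gap-bounds (inj₁ refl) zero    = z≤n , s≤s z≤n
gap-bounds (inj₁ refl) (suc k) = ≤-refl , ≤-trans (n≤1+n k) (m≤m+n (suc k) 1)
gap-bounds (inj₂ refl) N       = ≤-trans (m∸n≤m N 1) (m≤m+n N 1) , ≤-refl

gap≢0 : ∀ {ε} → IsSign ε → ∀ {N} → 2 ≤ N → gap ε N ≢ 0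
gap≢0 sε {N} 2≤N = >⇒≢ (≤-trans (<⇒≤pred 2≤N) (proj₁ (gap-bounds sε N)))

<⇒≤gap : ∀ {ε} → IsSign ε → ∀ {x M} → x < M → x ≤ gap ε M
<⇒≤gap sε {M = M} x<M = ≤-trans (<⇒≤pred x<M) (proj₁ (gap-bounds sε M))

gap-increasing : ∀ {ε} → IsSign ε → ∀ {b D} → 2 ≤ b → 3 ≤ D → gap ε D < gap ε (b * D)
gap-increasing {ε} sε {b} {D} 2≤b 3≤D = begin-strict
  gap ε D             ≤⟨ proj₂ (gap-bounds sε D) ⟩
  D + 1               <⟨ +-monoʳ-< D (<-≤-trans (s≤s (s≤s z≤n)) (<⇒≤pred 3≤D)) ⟩
  D + (D ∸ 1)         ≡⟨ +-∸-assoc D (≤-trans (s≤s z≤n) 3≤D) ⟨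
  (D + D) ∸ 1         ≡⟨ cong (λ t → (D + t) ∸ 1) (sym (+-identityʳ D)) ⟩
  2 * D ∸ 1           ≤⟨ ∸-monoˡ-≤ 1 (*-monoˡ-≤ D 2≤b) ⟩
  b * D ∸ 1           ≤⟨ proj₁ (gap-bounds sε (b * D)) ⟩
  gap ε (b * D)       ∎
  where open ≤-Reasoning

-- N and N − ε are coprime: a common divisor divides N − (N − ε) = ε.
shift-coprime : ∀ {ε} → IsSign ε → ∀ N {d} → d ∣ gap ε N → d ∣ N → d ≡ 1
shift-coprime {ε} sε N {d} d∣N-ε d∣N =
  ∣1⇒≡1 (subst (d ∣_) (∣sign∣≡1 sε) (ℤD.∣⇒∣ᵤ d∣ε))
  where
  N-[N-ε]≡ε : ∀ (X e : ℤ) → X ℤ.- (X ℤ.- e) ≡ e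
  N-[N-ε]≡ε = ℤ-Solver.solve-∀
  d∣ε : + d ℤD.∣ ε
  d∣ε = subst (+ d ℤD.∣_) (N-[N-ε]≡ε (+ N) ε)
    (ℤD.∣m∣n⇒∣m-n (ℤD.∣ᵤ⇒∣ {i = + N} d∣N) (ℤD.∣ᵤ⇒∣ {i = + N ℤ.- ε} d∣N-ε))

-- A common divisor of D − ε and bD − ε divides b(D − ε) − (bD − ε) = ε(1 − b).
common∣b∸1 : ∀ {ε} → IsSign ε → ∀ {b D d} → 1 ≤ b →
  d ∣ gap ε D → d ∣ gap ε (b * D) → d ∣ b ∸ 1
common∣b∸1 {ε} sε {suc k} {D} {d} _ d∣D-ε d∣bD-ε =
  subst (d ∣_) ∣ε[1-b]∣≡k (ℤD.∣⇒∣ᵤ d∣ε[1-b])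
  where
  b = suc k
  identity : ∀ (b D e : ℤ) → b ℤ.* (D ℤ.- e) ℤ.- (b ℤ.* D ℤ.- e) ≡ e ℤ.* (+ 1 ℤ.- b)
  identity = ℤ-Solver.solve-∀
  d∣ε[1-b] : + d ℤD.∣ ε ℤ.* (+ 1 ℤ.- + b)
  d∣ε[1-b] = subst (+ d ℤD.∣_)
    (trans (cong (λ t → + b ℤ.* (+ D ℤ.- ε) ℤ.- (t ℤ.- ε)) (ℤP.pos-* b D)) (identity (+ b) (+ D) ε))
    (ℤD.∣m∣n⇒∣m-n (ℤD.∣n⇒∣m*n (+ b) (ℤD.∣ᵤ⇒∣ {i = + D ℤ.- ε} d∣D-ε))
                  (ℤD.∣ᵤ⇒∣ {i = + (b * D) ℤ.- ε} d∣bD-ε))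
  ∣ε[1-b]∣≡k : ∣ ε ℤ.* (+ 1 ℤ.- + b) ∣ ≡ k
  ∣ε[1-b]∣≡k = begin
    ∣ ε ℤ.* (+ 1 ℤ.- + b) ∣      ≡⟨ ℤP.∣i*j∣≡∣i∣*∣j∣ ε _ ⟩
    ∣ ε ∣ * ∣ + 1 ℤ.- + b ∣      ≡⟨ cong (_* _) (∣sign∣≡1 sε) ⟩
    1 * ∣ + 1 ℤ.- + b ∣          ≡⟨ *-identityˡ _ ⟩
    ∣ + 1 ℤ.- + b ∣              ≡⟨ ℤP.∣i-j∣≡∣j-i∣ (+ 1) (+ b) ⟩
    k                            ∎
    where open ≡-Reasoning

gap-shift : ∀ {ε} d M K → d ∣ gap ε M → d ∣ gap ε (M + d * K)
gap-shift {ε} d M K d∣M-ε = ℤD.∣⇒∣ᵤ (subst (+ d ℤD.∣_) (sym regroup)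
  (ℤD.∣m∣n⇒∣m+n (ℤD.∣ᵤ⇒∣ {i = + M ℤ.- ε} d∣M-ε) (ℤD.∣m⇒∣m*n (+ K) (ℤD.∣-refl {+ d}))))
  where
  reassociate : ∀ (X Y e : ℤ) → X ℤ.+ Y ℤ.- e ≡ (X ℤ.- e) ℤ.+ Y
  reassociate = ℤ-Solver.solve-∀
  regroup : + (M + d * K) ℤ.- ε ≡ (+ M ℤ.- ε) ℤ.+ + d ℤ.* + K
  regroup = trans (cong (ℤ._- ε) (trans (ℤP.pos-+ M (d * K)) (cong (λ t → + M ℤ.+ t) (ℤP.pos-* d K))))
                  (reassociate (+ M) (+ d ℤ.* + K) ε)

prime>1 : ∀ {p} → Prime p → 1 < p
prime>1 {p} pp = nonTrivial⇒n>1 p {{prime⇒nonTrivial pp}}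

prime≢1 : ∀ {q} → Prime q → q ≢ 1
prime≢1 pq refl = ¬prime[1] pq

primePower≥2 : ∀ {a} → IsPrimePower a → 2 ≤ a
primePower≥2 (p , suc i , pp , _ , refl) =
  ≤-trans (prime>1 pp) (m≤m*n p (p ^ i) {{m^n≢0 p i {{prime⇒nonZero pp}}}})

prime∣^⇒≡ : ∀ {p q} → Prime p → Prime q → ∀ i → q ∣ p ^ i → q ≡ p
prime∣^⇒≡ pp pq zero q∣1 = ⊥-elim (prime≢1 pq (∣1⇒≡1 q∣1))
prime∣^⇒≡ {p} pp pq (suc i) q∣p^[1+i] with euclidsLemma p (p ^ i) pq q∣p^[1+i]
... | inj₁ q∣p   = [ (λ q≡1 → ⊥-elim (prime≢1 pq q≡1)) , id ]′ (prime⇒irreducible pp q∣p)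
... | inj₂ q∣p^i = prime∣^⇒≡ pp pq i q∣p^i

^-≤⇒∣ : ∀ {p} x α → 1 < p → p ^ x ≤ p ^ α → p ^ x ∣ p ^ α
^-≤⇒∣ {p} x α 1<p p^x≤p^α =
  divides (p ^ (α ∸ x)) (trans (cong (p ^_) (sym (m∸n+n≡m x≤α))) (^-distribˡ-+-* p (α ∸ x) x))
  where
  x≤α : x ≤ α
  x≤α = ≮⇒≥ (λ α<x → <⇒≱ (^-monoʳ-< p 1<p α<x) p^x≤p^α)

productOfTwo : ∀ {p r} fs → All (λ f → f ≡ p ⊎ f ≡ r) fs → ∃[ x ] ∃[ y ] product fs ≡ p ^ x * r ^ y
productOfTwo []       []           = 0 , 0 , refl
productOfTwo {p} {r} (f ∷ fs) (f≡ ∷ fs≡) with productOfTwo fs fs≡ | f≡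
... | x , y , eq | inj₁ refl = suc x , y , trans (cong (p *_) eq) (sym (*-assoc p (p ^ x) (r ^ y)))
... | x , y , eq | inj₂ refl = x , suc y , trans (cong (r *_) eq) (swap-front r (p ^ x) (r ^ y))
  where
  swap-front : ∀ r P R → r * (P * R) ≡ P * (r * R)
  swap-front = ℕ-Solver.solve-∀

twoPrimeForm : ∀ {p r} N → N ≢ 0 → (∀ q → Prime q → q ∣ N → q ≡ p ⊎ q ≡ r) →
  ∃[ x ] ∃[ y ] N ≡ p ^ x * r ^ y
twoPrimeForm N N≢0 onlyPR with factorise N {{≢-nonZero N≢0}}
... | record { factors = fs ; isFactorisation = N≡∏fs ; factorsPrime = fsPrime }
  with productOfTwo fs (All.tabulate (λ {f} f∈fs →
         onlyPR f (All.lookup fsPrime f∈fs) (subst (f ∣_) (sym N≡∏fs) (∈⇒∣product f∈fs))))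
... | x , y , ∏fs≡ = x , y , trans N≡∏fs ∏fs≡

powerOfPrime : ∀ {p i N} → Prime p → N ≢ 0 → SupportedBy N (p ^ i ∷ []) → ∃[ α ] N ≡ p ^ α
powerOfPrime {p} {i} pp N≢0 supp with twoPrimeForm {p} {p} _ N≢0
  (λ q pq q∣N → inj₁ (prime∣^⇒≡ pp pq i (AnyP.singleton⁻ (supp q pq q∣N))))
... | x , y , N≡ = x + y , trans N≡ (sym (^-distribˡ-+-* p x y))

twoPrimePowers : ∀ {p r i j N} → Prime p → Prime r → N ≢ 0 →
  SupportedBy N (p ^ i ∷ r ^ j ∷ []) → ∃[ x ] ∃[ y ] N ≡ p ^ x * r ^ y
twoPrimePowers {p} {r} {i} {j} {N} pp pr N≢0 supp = twoPrimeForm N N≢0 onlyPR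
  where
  onlyPR : ∀ q → Prime q → q ∣ N → q ≡ p ⊎ q ≡ r
  onlyPR q pq q∣N with supp q pq q∣N
  ... | here q∣p^i          = inj₁ (prime∣^⇒≡ pp pq i q∣p^i)
  ... | there (here q∣r^j)  = inj₂ (prime∣^⇒≡ pr pq j q∣r^j)
  ... | there (there ())

primePower∣ : ∀ {e N} → IsPrimePower e → N ≢ 0 → SupportedBy N (e ∷ []) → e ≤ N → e ∣ N
primePower∣ (p , l , pp , _ , refl) N≢0 supp e≤N with powerOfPrime {i = l} pp N≢0 supp
... | γ , refl = ^-≤⇒∣ l γ (prime>1 pp) e≤N

primePower∣gap : ∀ {ε} → IsSign ε → ∀ {e M} → IsPrimePower e → e < M →
  SupportedBy (gap ε M) (e ∷ []) → e ∣ gap ε M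
primePower∣gap sε e-pp e<M supp =
  primePower∣ e-pp (gap≢0 sε (≤-trans (primePower≥2 e-pp) (<⇒≤ e<M))) supp (<⇒≤gap sε e<M)

-- If pˣ ∣ D − ε and bD − ε is a power of p, then pˣ ≤ |D − ε| < |bD − ε|
-- so pˣ ∣ bD − ε too, and therefore pˣ ∣ b − 1.
powerBelow : ∀ {ε} → IsSign ε → ∀ {p x b D} → Prime p → 2 ≤ b → 3 ≤ D →
  p ^ x ∣ gap ε D → (∃[ α ] gap ε (b * D) ≡ p ^ α) → p ^ x ≤ b ∸ 1
powerBelow {ε} sε {p} {x} {b} {D} pp 2≤b 3≤D p^x∣D-ε (α , bD-ε≡p^α) =
  ∣⇒≤ {{≢-nonZero b∸1≢0}} (common∣b∸1 sε (<⇒≤ 2≤b) p^x∣D-ε p^x∣bD-ε)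
  where
  b∸1≢0 : b ∸ 1 ≢ 0
  b∸1≢0 = ≢-sym (<⇒≢ (<⇒≤pred 2≤b))
  p^x<p^α : p ^ x < p ^ α
  p^x<p^α = subst (p ^ x <_) bD-ε≡p^α
    (≤-<-trans (∣⇒≤ {{≢-nonZero (gap≢0 sε (<⇒≤ 3≤D))}} p^x∣D-ε) (gap-increasing sε 2≤b 3≤D))
  p^x∣bD-ε : p ^ x ∣ gap ε (b * D)
  p^x∣bD-ε = subst (p ^ x ∣_) (sym bD-ε≡p^α) (^-≤⇒∣ x α (prime>1 pp) (<⇒≤ p^x<p^α))

pairBound : ∀ {ε} → IsSign ε → ∀ {a b D} → IsPrimePower a → IsPrimePower b → 3 ≤ D →
  SupportedBy (gap ε D) (a ∷ b ∷ []) → SupportedBy (gap ε (b * D)) (a ∷ []) →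
  SupportedBy (gap ε (a * D)) (b ∷ []) → D ≤ suc ((a ∸ 1) * (b ∸ 1))
pairBound {ε} sε {a} {b} {D} a-pp@(p , i , pp , _ , refl) b-pp@(r , j , pr , _ , refl) 3≤D suppD suppBD suppAD
  with twoPrimePowers {i = i} {j = j} pp pr (gap≢0 sε (<⇒≤ 3≤D)) suppD
... | x , y , D-ε≡ = begin
  D                           ≤⟨ m≤n+m∸n D 1 ⟩
  suc (D ∸ 1)                 ≤⟨ s≤s (proj₁ (gap-bounds sε D)) ⟩
  suc (gap ε D)               ≡⟨ cong suc D-ε≡ ⟩
  suc (p ^ x * r ^ y)         ≤⟨ s≤s (*-mono-≤ p^x≤b∸1 r^y≤a∸1) ⟩
  suc ((b ∸ 1) * (a ∸ 1))     ≡⟨ cong suc (*-comm (b ∸ 1) (a ∸ 1)) ⟩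
  suc ((a ∸ 1) * (b ∸ 1))     ∎
  where
  open ≤-Reasoning
  2≤a : 2 ≤ a
  2≤a = primePower≥2 a-pp
  2≤b : 2 ≤ b
  2≤b = primePower≥2 b-pp
  D≢0 : NonZero D
  D≢0 = positive 3≤D
  p^x≤b∸1 : p ^ x ≤ b ∸ 1
  p^x≤b∸1 = powerBelow sε {x = x} pp 2≤b 3≤D (divides (r ^ y) (trans D-ε≡ (*-comm (p ^ x) (r ^ y))))
    (powerOfPrime {i = i} pp (gap≢0 sε (≤-trans 2≤b (m≤m*n b D {{D≢0}}))) suppBD)
  r^y≤a∸1 : r ^ y ≤ a ∸ 1
  r^y≤a∸1 = powerBelow sε {x = y} pr 2≤a 3≤D (divides (p ^ x) D-ε≡)
    (powerOfPrime {i = j} pr (gap≢0 sε (≤-trans 2≤a (m≤m*n a D {{D≢0}}))) suppAD)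

pairBound<square : ∀ {a b} → a < b → suc ((a ∸ 1) * (b ∸ 1)) < suc b * suc b
pairBound<square {a} {suc k} (s≤s a≤k) = s≤s (s≤s (begin
  (a ∸ 1) * k              ≤⟨ *-monoˡ-≤ k (≤-trans (m∸n≤m a 1) a≤k) ⟩
  k * k                    ≤⟨ *-mono-≤ (n≤1+n k) (≤-trans (n≤1+n k) (n≤1+n (suc k))) ⟩
  suc k * suc (suc k)      ≤⟨ m≤n+m _ k ⟩
  k + suc k * suc (suc k)  ∎))
  where open ≤-Reasoning

pairBound<product : ∀ {a b} → 2 ≤ a → 1 ≤ b → suc ((a ∸ 1) * (b ∸ 1)) < a * b
pairBound<product {suc (suc m)} {suc n} (s≤s (s≤s _)) (s≤s _) = s≤s (begin-strict
  suc m * n                <⟨ *-monoʳ-< (suc m) (n<1+n n) ⟩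
  suc m * suc n            ≤⟨ m≤n+m _ n ⟩
  n + suc m * suc n        ∎)
  where open ≤-Reasoning

coprime⇒*∣ : ∀ {m n t} → Coprime m n → m ∣ t → n ∣ t → m * n ∣ t
coprime⇒*∣ {m} {n} m⊥n m∣t (divides k t≡kn) = subst (m * n ∣_) (sym t≡kn)
  (*-pres-∣ (coprime-divisor m⊥n (subst (m ∣_) (trans t≡kn (*-comm k n)) m∣t)) (∣-refl {n}))

-- There are no 3 ≤ a < b < c with a ∣ bc − ε, b ∣ ac − ε, c ∣ ab − ε: then
-- a, b, c are pairwise coprime divisors of T = ab + bc + ca − ε, so abc ∣ T,
-- while 0 < |T| < abc.
egyptian : ∀ {ε} → IsSign ε → ∀ {a b c} → 3 ≤ a → a < b → b < c →
  a ∣ gap ε (b * c) → b ∣ gap ε (a * c) → c ∣ gap ε (a * b) → ⊥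
egyptian {ε} sε {a} {b} {c} 3≤a a<b b<c a∣bc-ε b∣ac-ε c∣ab-ε =
  <⇒≱ T<abc (∣⇒≤ {{≢-nonZero T≢0}} abc∣T)
  where
  Y = a * b + b * c + c * a
  around-a : ∀ a b c → a * b + b * c + c * a ≡ b * c + a * (b + c)
  around-a = ℕ-Solver.solve-∀
  around-b : ∀ a b c → a * b + b * c + c * a ≡ a * c + b * (a + c)
  around-b = ℕ-Solver.solve-∀
  around-c : ∀ a b c → a * b + b * c + c * a ≡ a * b + c * (a + b)
  around-c = ℕ-Solver.solve-∀
  a∣T : a ∣ gap ε Y
  a∣T = subst (λ t → a ∣ gap ε t) (sym (around-a a b c)) (gap-shift {ε} a (b * c) (b + c) a∣bc-ε)
  b∣T : b ∣ gap ε Y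
  b∣T = subst (λ t → b ∣ gap ε t) (sym (around-b a b c)) (gap-shift {ε} b (a * c) (a + c) b∣ac-ε)
  c∣T : c ∣ gap ε Y
  c∣T = subst (λ t → c ∣ gap ε t) (sym (around-c a b c)) (gap-shift {ε} c (a * b) (a + b) c∣ab-ε)
  a⊥b : Coprime a b
  a⊥b (d∣a , d∣b) = shift-coprime sε (b * c) (∣-trans d∣a a∣bc-ε) (∣-trans d∣b (m∣m*n c))
  ab⊥c : Coprime (a * b) c
  ab⊥c (d∣ab , d∣c) = shift-coprime sε (a * b) (∣-trans d∣c c∣ab-ε) d∣ab
  abc∣T : a * b * c ∣ gap ε Y
  abc∣T = coprime⇒*∣ ab⊥c (coprime⇒*∣ a⊥b a∣T b∣T) c∣T
  T≢0 : gap ε Y ≢ 0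
  T≢0 = gap≢0 sε (≤-trans (≤-trans (<⇒≤ 3≤a) (m≤m*n a b {{positive a<b}}))
                          (≤-trans (m≤m+n (a * b) (b * c)) (m≤m+n _ (c * a))))
  ab<bc : a * b < b * c
  ab<bc = subst (_< b * c) (*-comm b a) (*-monoʳ-< b {{positive a<b}} (<-trans a<b b<c))
  ca<bc : c * a < b * c
  ca<bc = subst (c * a <_) (*-comm c b) (*-monoʳ-< c {{positive b<c}} a<b)
  regroup : ∀ a b c → a * b + b * c + c * a + 1 ≡ a * b + (b * c + suc (c * a))
  regroup = ℕ-Solver.solve-∀
  triple : ∀ x → x + (x + x) ≡ 3 * x
  triple = ℕ-Solver.solve-∀
  T<abc : gap ε Y < a * b * c
  T<abc = begin-strict
    gap ε Y                          ≤⟨ proj₂ (gap-bounds sε Y) ⟩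
    Y + 1                            ≡⟨ regroup a b c ⟩
    a * b + (b * c + suc (c * a))    <⟨ +-mono-<-≤ ab<bc (+-monoʳ-≤ (b * c) ca<bc) ⟩
    b * c + (b * c + b * c)          ≡⟨ triple (b * c) ⟩
    3 * (b * c)                      ≤⟨ *-monoˡ-≤ (b * c) 3≤a ⟩
    a * (b * c)                      ≡⟨ *-assoc a b c ⟨
    a * b * c                        ∎
    where open ≤-Reasoning

insert : ℕ → List ℕ → List ℕ
insert x [] = x ∷ []
insert x (y ∷ ys) with <-cmp x y
... | tri< _ _ _ = x ∷ y ∷ ys
... | tri≈ _ _ _ = y ∷ ys
... | tri> _ _ _ = y ∷ insert x ys

insert-All : ∀ {P : ℕ → Set} {x} ys → P x → All P ys → All P (insert x ys)
insert-All [] px [] = px ∷ []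
insert-All {x = x} (y ∷ ys) px (py ∷ pys) with <-cmp x y
... | tri< _ _ _ = px ∷ py ∷ pys
... | tri≈ _ _ _ = py ∷ pys
... | tri> _ _ _ = py ∷ insert-All ys px pys

insert-sorted : ∀ x ys → AllPairs _<_ ys → AllPairs _<_ (insert x ys)
insert-sorted x [] [] = [] ∷ []
insert-sorted x (y ∷ ys) (y<ys ∷ sorted) with <-cmp x y
... | tri< x<y _ _ = (x<y ∷ All.map (<-trans x<y) y<ys) ∷ y<ys ∷ sorted
... | tri≈ _ _ _   = y<ys ∷ sorted
... | tri> _ _ y<x = insert-All ys y<x y<ys ∷ insert-sorted x ys sorted

x∈insert : ∀ x ys → x ∈ insert x ys
x∈insert x [] = here refl
x∈insert x (y ∷ ys) with <-cmp x y
... | tri< _ _ _   = here refl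
... | tri≈ _ x≡y _ = here x≡y
... | tri> _ _ _   = there (x∈insert x ys)

∈⇒∈insert : ∀ {n} x ys → n ∈ ys → n ∈ insert x ys
∈⇒∈insert x (y ∷ ys) n∈ with <-cmp x y
... | tri< _ _ _ = there n∈
... | tri≈ _ _ _ = n∈
∈⇒∈insert x (y ∷ ys) (here n≡y)  | tri> _ _ _ = here n≡y
∈⇒∈insert x (y ∷ ys) (there n∈ys) | tri> _ _ _ = there (∈⇒∈insert x ys n∈ys)

-- As
-- membership in A is undecidable this only holds under a double negation:
-- for each x either A x (insert it) or ¬ A x (skip it).
enumerate : (A : ℕ → Set) → ∀ xs →
  ¬ ¬ (∃[ L ] (AllPairs _<_ L × All A L × (∀ n → A n → n ∈ xs → n ∈ L)))
enumerate A [] k = k ([] , [] , [] , λ _ _ ())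
enumerate A (x ∷ xs) k = enumerate A xs λ (L , sorted , inA , covers) →
  let keep : A x → ⊥
      keep Ax = k (insert x L , insert-sorted x L sorted , insert-All L Ax inA ,
                   λ { n An (here refl) → x∈insert x L ; n An (there n∈xs) → ∈⇒∈insert x L (covers n An n∈xs) })
  in k (L , sorted , inA , λ { n An (here refl) → ⊥-elim (keep An) ; n An (there n∈xs) → covers n An n∈xs })

pigeonhole : ∀ {x y z u v : ℕ} → x ≢ y → x ≢ z → y ≢ z →
  x ∈ u ∷ v ∷ [] → y ∈ u ∷ v ∷ [] → z ∈ u ∷ v ∷ [] → ⊥
pigeonhole x≢y _ _ (here refl) (here refl) _ = x≢y refl
pigeonhole x≢y _ _ (there (here refl)) (there (here refl)) _ = x≢y refl
pigeonhole _ x≢z _ (here refl) _ (here refl) = x≢z refl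
pigeonhole _ x≢z _ (there (here refl)) _ (there (here refl)) = x≢z refl
pigeonhole _ _ y≢z _ (here refl) (here refl) = y≢z refl
pigeonhole _ _ y≢z _ (there (here refl)) (there (here refl)) = y≢z refl
pigeonhole _ _ _ (there (there ())) _ _
pigeonhole _ _ _ _ (there (there ())) _
pigeonhole _ _ _ _ _ (there (there ()))

¬⊆pair : ∀ {A : ℕ → Set} → AtLeast3 A → ∀ u v → ¬ (∀ n → A n → n ∈ u ∷ v ∷ [])
¬⊆pair (x , y , z , Ax , Ay , Az , x≢y , x≢z , y≢z) u v A⊆ =
  pigeonhole x≢y x≢z y≢z (A⊆ x Ax) (A⊆ y Ay) (A⊆ z Az)

head≤product : ∀ {x xs} → All NonZero xs → x ≤ product (x ∷ xs)
head≤product {x} {xs} nonZero = m≤m*n x (product xs) {{product≢0 nonZero}}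

above⇒nonZero : ∀ {a xs} → All (a <_) xs → All NonZero xs
above⇒nonZero = All.map positive

module FiniteCase {ε : ℤ} (sε : IsSign ε) {A : ℕ → Set}
  (primePowers : ∀ a → A a → IsPrimePower a)
  (hyp : ∀ (B : List ℕ) → IsFinNonemptyProperSubset A B →
         ∀ (q : ℕ) → Prime q → q ∣ ∣ prodMinus B ε ∣ → ∃[ a ] (A a × q ∣ a)) where

  -- If A ⊆ X ∪ B then every prime factor of ∏B − ε divides an element of X:
  -- it divides an element of A, which cannot lie in B since ∏B ⊥ ∏B − ε.
  missingFactor : ∀ {B} X → IsFinNonemptyProperSubset A B →
    (∀ e → A e → e ∈ X ⊎ e ∈ B) → SupportedBy (gap ε (product B)) X
  missingFactor {B} X B-proper A⊆X∪B q pq q∣∏B-ε with hyp B B-proper q pq q∣∏B-ε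
  ... | e , Ae , q∣e with A⊆X∪B e Ae
  ...   | inj₁ e∈X = Any.map (λ { refl → q∣e }) e∈X
  ...   | inj₂ e∈B = ⊥-elim (prime≢1 pq (shift-coprime sε (product B) q∣∏B-ε (∣-trans q∣e (∈⇒∣product e∈B))))

  properSubset : ∀ {x y ys} → AllPairs _<_ (y ∷ ys) → All A (y ∷ ys) → A x →
    All (x ≢_) (y ∷ ys) → IsFinNonemptyProperSubset A (y ∷ ys)
  properSubset sorted inA Ax x∉ = AllPairs.map <⇒≢ sorted , inA , (λ ()) , _ , Ax , All¬⇒¬Any x∉

  support-D : ∀ {a b c R'} → Enumeration A (a ∷ b ∷ c ∷ R') →
    SupportedBy (gap ε (product (c ∷ R'))) (a ∷ b ∷ [])
  support-D {a} {b} ((_ ∷ a<R) ∷ _ ∷ sorted , Aa ∷ _ ∷ inA , covers) =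
    missingFactor (a ∷ b ∷ []) (properSubset sorted inA Aa (All.map <⇒≢ a<R))
      (λ e Ae → ∈-++⁻ (a ∷ b ∷ []) (covers e Ae))

  support-bD : ∀ {a b c R'} → Enumeration A (a ∷ b ∷ c ∷ R') →
    SupportedBy (gap ε (b * product (c ∷ R'))) (a ∷ [])
  support-bD {a} (a<bR ∷ b<R ∷ sorted , Aa ∷ Ab ∷ inA , covers) =
    missingFactor (a ∷ []) (properSubset (b<R ∷ sorted) (Ab ∷ inA) Aa (All.map <⇒≢ a<bR))
      (λ e Ae → ∈-++⁻ (a ∷ []) (covers e Ae))

  support-aD : ∀ {a b c R'} → Enumeration A (a ∷ b ∷ c ∷ R') →
    SupportedBy (gap ε (a * product (c ∷ R'))) (b ∷ [])
  support-aD {a} {b} {c} {R'} ((a<b ∷ a<R) ∷ b<R ∷ sorted , Aa ∷ Ab ∷ inA , covers) =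
    missingFactor (b ∷ []) (properSubset (a<R ∷ sorted) (Aa ∷ inA) Ab (>⇒≢ a<b ∷ All.map <⇒≢ b<R))
      (λ e Ae → b-first (covers e Ae))
    where
    b-first : ∀ {e} → e ∈ a ∷ b ∷ c ∷ R' → e ∈ b ∷ [] ⊎ e ∈ a ∷ c ∷ R'
    b-first (here e≡a)         = inj₂ (here e≡a)
    b-first (there (here e≡b)) = inj₁ (here e≡b)
    b-first (there (there e∈R)) = inj₂ (there e∈R)

  support-ab : ∀ {a b c} → Enumeration A (a ∷ b ∷ c ∷ []) →
    SupportedBy (gap ε (product (a ∷ b ∷ []))) (c ∷ [])
  support-ab {a} {b} ((a<b ∷ a<c ∷ []) ∷ (b<c ∷ []) ∷ _ , Aa ∷ Ab ∷ Ac ∷ [] , covers) =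
    missingFactor (_ ∷ []) (properSubset ((a<b ∷ []) ∷ [] ∷ []) (Aa ∷ Ab ∷ []) Ac (>⇒≢ a<c ∷ >⇒≢ b<c ∷ []))
      (λ e Ae → Sum.swap (∈-++⁻ (a ∷ b ∷ []) (covers e Ae)))

  enumerationBound : ∀ {a b c R'} → Enumeration A (a ∷ b ∷ c ∷ R') →
    product (c ∷ R') ≤ suc ((a ∸ 1) * (b ∸ 1))
  enumerationBound {c = c} {R'} enum@((a<b ∷ _) ∷ (b<c ∷ _) ∷ (c<R' ∷ _) , Aa ∷ Ab ∷ _ , _) =
    pairBound sε (primePowers _ Aa) (primePowers _ Ab) 3≤D (support-D enum) (support-bD enum) (support-aD enum)
    where
    3≤D : 3 ≤ product (c ∷ R')
    3≤D = ≤-trans (<-≤-trans (≤-<-trans (primePower≥2 (primePowers _ Aa)) a<b) (<⇒≤ b<c))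
                  (head≤product (above⇒nonZero c<R'))

  noEnumeration≥4 : ∀ {a b c d R''} → ¬ Enumeration A (a ∷ b ∷ c ∷ d ∷ R'')
  noEnumeration≥4 {a} {b} {c} {d} {R''} enum@((a<b ∷ _) ∷ (b<c ∷ b<d ∷ _) ∷ _ ∷ (d<R'' ∷ _) , _) =
    <⇒≱ (begin-strict
      suc ((a ∸ 1) * (b ∸ 1))  <⟨ pairBound<square a<b ⟩
      suc b * suc b            ≤⟨ *-mono-≤ b<c b<d ⟩
      c * d                    ≤⟨ *-monoʳ-≤ c (head≤product (above⇒nonZero d<R'')) ⟩
      c * (d * product R'')    ∎) (enumerationBound enum)
    where open ≤-Reasoning

  -- With exactly three elements: c ≤ (a − 1)(b − 1) + 1.  For a = 2 this says
  -- c ≤ b; for a ≥ 3 each element divides the product of the other two minus ε.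
  noEnumeration3 : ∀ {a b c} → ¬ Enumeration A (a ∷ b ∷ c ∷ [])
  noEnumeration3 {a} {b} {c} enum@((a<b ∷ a<c ∷ []) ∷ (b<c ∷ []) ∷ _ , Aa ∷ Ab ∷ Ac ∷ [] , _)
    with m≤n⇒m<n∨m≡n (primePower≥2 (primePowers a Aa))
  ... | inj₂ 2≡a = <⇒≱ b<c c≤b
    where
    open ≤-Reasoning
    c≤b : c ≤ b
    c≤b = begin
      c                          ≡⟨ *-identityʳ c ⟨
      c * 1                      ≤⟨ enumerationBound enum ⟩
      suc ((a ∸ 1) * (b ∸ 1))    ≡⟨ cong (λ t → suc ((t ∸ 1) * (b ∸ 1))) 2≡a ⟨
      suc (1 * (b ∸ 1))          ≡⟨ cong suc (*-identityˡ (b ∸ 1)) ⟩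
      suc (b ∸ 1)                ≡⟨ suc-pred b {{positive a<b}} ⟩
      b                          ∎
  ... | inj₁ 3≤a = egyptian sε 3≤a a<b b<c
    (subst (λ t → a ∣ gap ε (b * t)) (*-identityʳ c) (primePower∣gap sε (primePowers a Aa) a<bc (support-bD enum)))
    (subst (λ t → b ∣ gap ε (a * t)) (*-identityʳ c) (primePower∣gap sε (primePowers b Ab) b<ac (support-aD enum)))
    (subst (λ t → c ∣ gap ε (a * t)) (*-identityʳ b) (primePower∣gap sε (primePowers c Ac) c<ab (support-ab enum)))
    where
    open ≤-Reasoning
    a<bc : a < b * (c * 1)
    a<bc = <-≤-trans a<b (m≤m*n b (c * 1) {{positive (subst (a <_) (sym (*-identityʳ c)) a<c)}})
    b<ac : b < a * (c * 1)
    b<ac = <-≤-trans (subst (b <_) (sym (*-identityʳ c)) b<c) (m≤n*m (c * 1) a {{positive (<-trans (s≤s z≤n) 3≤a)}})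
    c<ab : c < a * (b * 1)
    c<ab = begin-strict
      c                          ≡⟨ *-identityʳ c ⟨
      c * 1                      ≤⟨ enumerationBound enum ⟩
      suc ((a ∸ 1) * (b ∸ 1))    <⟨ pairBound<product (<⇒≤ 3≤a) (≤-<-trans z≤n a<b) ⟩
      a * b                      ≡⟨ cong (a *_) (*-identityʳ b) ⟨
      a * (b * 1)                ∎

  noEnumeration : AtLeast3 A → ∀ L → ¬ Enumeration A L
  noEnumeration (x , _ , _ , Ax , _) [] (_ , _ , covers) with covers x Ax
  ... | ()
  noEnumeration three (u ∷ [])     (_ , _ , covers) = ¬⊆pair three u u (λ n An → ∈-++⁺ˡ (covers n An))
  noEnumeration three (u ∷ v ∷ []) (_ , _ , covers) = ¬⊆pair three u v covers
  noEnumeration _ (_ ∷ _ ∷ _ ∷ [])     enum = noEnumeration3 enum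
  noEnumeration _ (_ ∷ _ ∷ _ ∷ _ ∷ _) enum = noEnumeration≥4 enum

lemma8 : (ε₀ : ℤ) → IsSign ε₀ →
    (A : ℕ → Set) → (∀ a → A a → IsPrimePower a) → AtLeast3 A →
    (∀ (B : List ℕ) → IsFinNonemptyProperSubset A B →
      ∀ (q : ℕ) → Prime q → q ∣ ∣ prodMinus B ε₀ ∣ →
      ∃[ a ] (A a × q ∣ a)) →
    ¬ FiniteSet A
lemma8 ε₀ sε A primePowers three hyp (xs , finite) =
  enumerate A xs λ (L , sorted , inA , covers) →
    FiniteCase.noEnumeration sε primePowers hyp three L
      (sorted , inA , λ n An → covers n An (finite n An))
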